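{- Let $n\ge2$, $a_1,\ldots,a_{n-1}$ nonnegative integers, $\lambda_i=a_i+\ldots+a_{n-1}$ for $1\le i\le n-1$ and $\lambda_n=0$. For every $E\in\mathbf R_p$, with $b(E)=\sum_{1\le i<j\le n}x(E)_{i,j}$, one has $2b(E)=\sum_{i=1}^n|\lambda_i-\lambda_{w(E)(i)}|$.
   Context: $U=\mathbb R^{\binom n2}$ with coordinates $x_{i,j}$, $1\le i<j\le n$. $R$ is the set of segments $[i,j]$, integers $1\le i<j\le n$; $\mathbf R_p$ is the set of $E\subset R$ such that for any two segments in $E$ with nonempty intersection, the intersection belongs to $E$. With $d^{i,j}=((i,i+1),\ldots,(i,j),(i+1,j),\ldots,(j-1,j))$ and $S(x,d^{i,j})=\sum_{(k,l)\in d^{i,j}}x_{k,l}$, $x(E)$ is the unique point of $U$ with $x(E)_{i,j}=0$ if $[i,j]\notin E$ and $S(x(E),d^{i,j})=a_i+\ldots+a_{j-1}$ if $[i,j]\in E$. $w(E)\in S_n$ is the product of the transpositions $(i\ j)$ over $[i,j]\in E$, ordered so that whenever $[a,b],[c,d]\in E$ and $b-a<d-c$, $(a\ b)$ stands to the right of $(c\ d)$ (rightmost factor applied first). -}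

module Defs where

open import Data.Nat using (ℕ; zero; suc; _+_; _*_; _∸_; _≤_; _<_; _⊔_; _⊓_; _≡ᵇ_; ∣_-_∣)
open import Data.Bool using (Bool; true; false; if_then_else_)
open import Data.List using (List; map; upTo; foldr; foldl; concatMap)
open import Data.Nat.ListAction using (sum)
open import Data.Integer as ℤ using (ℤ)
open import Data.Product using (_×_; Σ)
open import Relation.Binary.PropositionalEquality using (_≡_)

range : ℕ → ℕ → List ℕ
range i j = map (i +_) (upTo (j ∸ i))

sumℤ : List ℤ → ℤ
sumℤ = foldr ℤ._+_ (ℤ.+ 0)

aSum : (ℕ → ℕ) → ℕ → ℕ → ℕ
aSum a i j = sum (map a (range i j))

lam : (ℕ → ℕ) → ℕ → ℕ → ℕ
lam a n i = aSum a i n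

-- A point of U = ℝ^{n choose 2} (integer-valued): coordinate x i j for 1 ≤ i < j ≤ n
Point : Set
Point = ℕ → ℕ → ℤ

-- A subset of segments, given by its membership function: E i j ≡ true iff [i,j] ∈ E
SegSet : Set
SegSet = ℕ → ℕ → Bool

InR : ℕ → SegSet → Set
InR n E = ∀ i j → E i j ≡ true → (1 ≤ i) × (i < j) × (j ≤ n)

-- E ∈ R_p : E ⊆ R and whenever [a,b],[c,d] ∈ E intersect (as real intervals),
-- the intersection [max a c, min b d] is a segment of R lying in E.
InRp : ℕ → SegSet → Set
InRp n E = InR n E ×
  (∀ a b c d → E a b ≡ true → E c d ≡ true → (a ⊔ c) ≤ (b ⊓ d) →
     ((a ⊔ c) < (b ⊓ d)) × (E (a ⊔ c) (b ⊓ d) ≡ true))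

S : Point → ℕ → ℕ → ℤ
S x i j = sumℤ (map (λ k → x i k) (range (suc i) (suc j)))
     ℤ.+ sumℤ (map (λ k → x k j) (range (suc i) j))

IsXE : ℕ → (ℕ → ℕ) → SegSet → Point → Set
IsXE n a E x = ∀ i j → 1 ≤ i → i < j → j ≤ n →
  (E i j ≡ false → x i j ≡ ℤ.+ 0) × (E i j ≡ true → S x i j ≡ ℤ.+ (aSum a i j))

bSum : ℕ → Point → ℤ
bSum n x = sumℤ (concatMap (λ i → map (λ j → x i j) (range (suc i) (suc n))) (range 1 (suc n)))

transp : ℕ → ℕ → ℕ → ℕ
transp a b i = if i ≡ᵇ a then b else (if i ≡ᵇ b then a else i)

-- apply all transpositions (a, a+L) with [a,a+L] ∈ E (they commute for E ∈ R_p)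
stepLen : ℕ → SegSet → ℕ → ℕ → ℕ
stepLen n E L i = foldl (λ k a → if E a (a + L) then transp a (a + L) k else k) i (range 1 (suc n))

-- w(E)(i): product of transpositions, shorter segments to the right (applied first)
w : ℕ → SegSet → ℕ → ℕ
w n E i = foldl (λ k L → stepLen n E L k) i (range 1 n)

module Submission where

-- Add the segments of E one at a time, shortest first (ties broken from the left), and let w′ be the
-- partial product of transpositions. The point x(E′) of each intermediate set is tracked through its
-- net flow Σ_{l>m} x_{m,l} − Σ_{l<m} x_{l,m} out of each vertex m, which equals λ_m − λ_{w′⁻¹(m)}.
-- When [i,j] is added, the intersection property of E forbids earlier segments that end at i, start at j,
-- start at i and pass j, or end at j and start left of i; so S(x, d^{i,j}) is flow(i) − flow(j) plus the one
-- new coordinate, which is therefore λ_{w′⁻¹(i)} − λ_{w′⁻¹(j)}. Both w′⁻¹(i) and w′⁻¹(j) lie in [i,j],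
-- where λ decreases, so multiplying w′ by (i j) raises Σ_m |λ_m − λ_{w′(m)}| by twice that coordinate,
-- exactly as much as it raises 2b.

open import Defs
open import Data.Nat using (ℕ; zero; suc; _+_; _∸_; _≤_; _<_; _⊔_; _⊓_; _≡ᵇ_; ∣_-_∣; z≤n; s≤s; s≤s⁻¹; _≤?_; _≟_)
open import Data.Nat.Properties
open import Data.Bool using (true; false; if_then_else_; _∧_; _∨_)
open import Data.Bool.Properties using (¬-not)
open import Data.List using (List; []; _∷_; map; upTo; foldl; concatMap; _++_; [_])
open import Data.List.Properties using (map-++; upTo-∷ʳ; foldl-++)
open import Data.List.Relation.Unary.All as All using (All; []; _∷_)
open import Data.Nat.ListAction using (sum)
open import Data.Integer as ℤ using (ℤ; +_; -_; _-_; _⊖_) renaming (_+_ to _+ℤ_; _*_ to _*ℤ_)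
import Data.Integer.Properties as ℤP
open import Data.Integer.Tactic.RingSolver using (solve-∀)
open import Algebra.Properties.AbelianGroup ℤP.+-0-abelianGroup using (identityʳ-unique)
import Data.Nat.Tactic.RingSolver as ℕ-Solver
open import Data.Product using (_×_; Σ; _,_; proj₁; proj₂)
open import Data.Sum using (_⊎_; inj₁; inj₂)
open import Data.Product.Relation.Binary.Lex.Strict using (×-Lex)
open import Data.Empty using (⊥; ⊥-elim)
open import Data.Unit using (⊤; tt)
open import Function using (case_of_)
open import Relation.Nullary using (yes; no)
open import Relation.Binary.PropositionalEquality
  using (_≡_; _≢_; refl; sym; trans; cong; cong₂; subst; subst₂; ≢-sym; module ≡-Reasoning)

open ≡-Reasoning

-- Sums over ranges

range-empty : ∀ {i j} → j ≤ i → range i j ≡ []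
range-empty j≤i rewrite m≤n⇒m∸n≡0 j≤i = refl

range-snoc : ∀ {i j} → i ≤ j → range i (suc j) ≡ range i j ++ [ j ]
range-snoc {i} {j} i≤j = begin
  map (i+) (upTo (suc j ∸ i))           ≡⟨ cong (λ k → map (i+) (upTo k)) (+-∸-assoc 1 i≤j) ⟩
  map (i+) (upTo (suc (j ∸ i)))         ≡⟨ cong (map (i+)) (upTo-∷ʳ (j ∸ i)) ⟨
  map (i+) (upTo (j ∸ i) ++ [ j ∸ i ])  ≡⟨ map-++ (i+) (upTo (j ∸ i)) [ j ∸ i ] ⟩
  range i j ++ [ i + (j ∸ i) ]          ≡⟨ cong (λ k → range i j ++ [ k ]) (m+[n∸m]≡n i≤j) ⟩
  range i j ++ [ j ]                    ∎
  where
  i+ : ℕ → ℕ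
  i+ k = i + k

foldl-range-snoc : ∀ {A : Set} (f : A → ℕ → A) z k →
  foldl f z (range 1 (suc (suc k))) ≡ f (foldl f z (range 1 (suc k))) (suc k)
foldl-range-snoc f z k = trans (cong (foldl f z) (range-snoc {1} {suc k} (s≤s z≤n))) (foldl-++ f z (range 1 (suc k)) [ suc k ])

sumℤ-++ : ∀ xs ys → sumℤ (xs ++ ys) ≡ sumℤ xs +ℤ sumℤ ys
sumℤ-++ []       ys = sym (ℤP.+-identityˡ _)
sumℤ-++ (x ∷ xs) ys = trans (cong (x +ℤ_) (sumℤ-++ xs ys)) (sym (ℤP.+-assoc x _ _))

sumℤ-concatMap : ∀ {A : Set} (g : A → List ℤ) xs →
  sumℤ (concatMap g xs) ≡ sumℤ (map (λ i → sumℤ (g i)) xs)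
sumℤ-concatMap g []       = refl
sumℤ-concatMap g (x ∷ xs) = trans (sumℤ-++ (g x) (concatMap g xs)) (cong (sumℤ (g x) +ℤ_) (sumℤ-concatMap g xs))

+-sum : ∀ (f : ℕ → ℕ) xs → + sum (map f xs) ≡ sumℤ (map (λ z → + f z) xs)
+-sum f []       = refl
+-sum f (x ∷ xs) = trans (ℤP.pos-+ (f x) (sum (map f xs))) (cong (+ f x +ℤ_) (+-sum f xs))

≡ᵇ-refl : ∀ n → (n ≡ᵇ n) ≡ true
≡ᵇ-refl zero    = refl
≡ᵇ-refl (suc n) = ≡ᵇ-refl n

≢⇒≡ᵇ-false : ∀ {m n} → m ≢ n → (m ≡ᵇ n) ≡ false
≢⇒≡ᵇ-false {zero}  {zero}  m≢n = ⊥-elim (m≢n refl)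
≢⇒≡ᵇ-false {zero}  {suc n} m≢n = refl
≢⇒≡ᵇ-false {suc m} {zero}  m≢n = refl
≢⇒≡ᵇ-false {suc m} {suc n} m≢n = ≢⇒≡ᵇ-false (λ m≡n → m≢n (cong suc m≡n))

∑ : (ℕ → ℤ) → ℕ → ℕ → ℤ
∑ f i j = sumℤ (map f (range i j))

∑-empty : ∀ f {i j} → j ≤ i → ∑ f i j ≡ + 0
∑-empty f j≤i rewrite range-empty j≤i = refl

∑-snoc : ∀ f {i j} → i ≤ j → ∑ f i (suc j) ≡ ∑ f i j +ℤ f j
∑-snoc f {i} {j} i≤j = begin
  sumℤ (map f (range i (suc j)))       ≡⟨ cong (λ l → sumℤ (map f l)) (range-snoc i≤j) ⟩
  sumℤ (map f (range i j ++ [ j ]))    ≡⟨ cong sumℤ (map-++ f (range i j) [ j ]) ⟩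
  sumℤ (map f (range i j) ++ [ f j ])  ≡⟨ sumℤ-++ (map f (range i j)) [ f j ] ⟩
  ∑ f i j +ℤ (f j +ℤ + 0)              ≡⟨ cong (∑ f i j +ℤ_) (ℤP.+-identityʳ (f j)) ⟩
  ∑ f i j +ℤ f j                       ∎

∑-cong : ∀ f g i j → (∀ l → i ≤ l → l < j → f l ≡ g l) → ∑ f i j ≡ ∑ g i j
∑-cong f g i zero    f≗g = trans (∑-empty f {i} z≤n) (sym (∑-empty g {i} z≤n))
∑-cong f g i (suc j) f≗g with i ≤? j
... | yes i≤j = begin
  ∑ f i (suc j)   ≡⟨ ∑-snoc f i≤j ⟩
  ∑ f i j +ℤ f j  ≡⟨ cong₂ _+ℤ_ (∑-cong f g i j (λ l i≤l l<j → f≗g l i≤l (m<n⇒m<1+n l<j))) (f≗g j i≤j ≤-refl) ⟩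
  ∑ g i j +ℤ g j  ≡⟨ ∑-snoc g i≤j ⟨
  ∑ g i (suc j)   ∎
... | no i≰j = trans (∑-empty f (≰⇒> i≰j)) (sym (∑-empty g (≰⇒> i≰j)))

∑-zero : ∀ f i j → (∀ l → i ≤ l → l < j → f l ≡ + 0) → ∑ f i j ≡ + 0
∑-zero f i j f≗0 = trans (∑-cong f (λ _ → + 0) i j f≗0) (zeros (range i j))
  where
  zeros : ∀ xs → sumℤ (map (λ _ → + 0) xs) ≡ + 0
  zeros []       = refl
  zeros (_ ∷ xs) = trans (ℤP.+-identityˡ _) (zeros xs)

∑-split : ∀ f {i j k} → i ≤ j → j ≤ k → ∑ f i k ≡ ∑ f i j +ℤ ∑ f j k
∑-split f {i} {j} {k} i≤j j≤k with m≤n⇒m<n∨m≡n j≤k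
... | inj₂ refl = begin
  ∑ f i j                 ≡⟨ ℤP.+-identityʳ _ ⟨
  ∑ f i j +ℤ + 0          ≡⟨ cong (∑ f i j +ℤ_) (∑-empty f {j} ≤-refl) ⟨
  ∑ f i j +ℤ ∑ f j j      ∎
∑-split f {i} {j} {suc k} i≤j _ | inj₁ (s≤s j≤k) = begin
  ∑ f i (suc k)                  ≡⟨ ∑-snoc f (≤-trans i≤j j≤k) ⟩
  ∑ f i k +ℤ f k                 ≡⟨ cong (_+ℤ f k) (∑-split f i≤j j≤k) ⟩
  ∑ f i j +ℤ ∑ f j k +ℤ f k      ≡⟨ ℤP.+-assoc (∑ f i j) _ _ ⟩
  ∑ f i j +ℤ (∑ f j k +ℤ f k)    ≡⟨ cong (∑ f i j +ℤ_) (∑-snoc f j≤k) ⟨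
  ∑ f i j +ℤ ∑ f j (suc k)       ∎

∑-extract : ∀ f {i p j} → i ≤ p → p < j → ∑ f i j ≡ ∑ f i p +ℤ f p +ℤ ∑ f (suc p) j
∑-extract f {i} {p} {j} i≤p p<j = begin
  ∑ f i j                           ≡⟨ ∑-split f (m≤n⇒m≤1+n i≤p) p<j ⟩
  ∑ f i (suc p) +ℤ ∑ f (suc p) j    ≡⟨ cong (_+ℤ ∑ f (suc p) j) (∑-snoc f i≤p) ⟩
  ∑ f i p +ℤ f p +ℤ ∑ f (suc p) j   ∎

∑-update : ∀ f g {i j} p → i ≤ p → p < j → (∀ l → i ≤ l → l < j → l ≢ p → f l ≡ g l) →
  ∑ f i j ≡ ∑ g i j +ℤ (f p - g p)
∑-update f g {i} {j} p i≤p p<j f≗g = begin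
  ∑ f i j                                         ≡⟨ ∑-extract f i≤p p<j ⟩
  ∑ f i p +ℤ f p +ℤ ∑ f (suc p) j                 ≡⟨ cong₂ (λ u v → u +ℤ f p +ℤ v) below above ⟩
  ∑ g i p +ℤ f p +ℤ ∑ g (suc p) j                 ≡⟨ shift (∑ g i p) (∑ g (suc p) j) (f p) (g p) ⟩
  ∑ g i p +ℤ g p +ℤ ∑ g (suc p) j +ℤ (f p - g p)  ≡⟨ cong (_+ℤ (f p - g p)) (∑-extract g i≤p p<j) ⟨
  ∑ g i j +ℤ (f p - g p)                          ∎
  where
  below : ∑ f i p ≡ ∑ g i p
  below = ∑-cong f g i p (λ l i≤l l<p → f≗g l i≤l (<-trans l<p p<j) (<⇒≢ l<p))
  above : ∑ f (suc p) j ≡ ∑ g (suc p) j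
  above = ∑-cong f g (suc p) j (λ l p<l l<j → f≗g l (≤-trans i≤p (<⇒≤ p<l)) l<j (≢-sym (<⇒≢ p<l)))
  shift : ∀ (A B u v : ℤ) → A +ℤ u +ℤ B ≡ A +ℤ v +ℤ B +ℤ (u - v)
  shift = solve-∀

∑-update₂ : ∀ f g {i j} p r → p ≢ r → i ≤ p → p < j → i ≤ r → r < j →
  (∀ l → i ≤ l → l < j → l ≢ p → l ≢ r → f l ≡ g l) →
  ∑ f i j ≡ ∑ g i j +ℤ (f p - g p) +ℤ (f r - g r)
∑-update₂ f g {i} {j} p r p≢r i≤p p<j i≤r r<j f≗g = begin
  ∑ f i j                                      ≡⟨ ∑-update f h p i≤p p<j (λ l _ _ l≢p → sym (h-off l l≢p)) ⟩
  ∑ h i j +ℤ (f p - h p)                       ≡⟨ cong₂ _+ℤ_ (∑-update h g r i≤r r<j h≗g) (cong (λ u → f p - u) h-at) ⟩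
  ∑ g i j +ℤ (h r - g r) +ℤ (f p - g p)        ≡⟨ cong (λ u → ∑ g i j +ℤ (u - g r) +ℤ (f p - g p)) (h-off r (≢-sym p≢r)) ⟩
  ∑ g i j +ℤ (f r - g r) +ℤ (f p - g p)        ≡⟨ swap (∑ g i j) (f r - g r) (f p - g p) ⟩
  ∑ g i j +ℤ (f p - g p) +ℤ (f r - g r)        ∎
  where
  h : ℕ → ℤ
  h l = if l ≡ᵇ p then g l else f l
  h-off : ∀ l → l ≢ p → h l ≡ f l
  h-off l l≢p rewrite ≢⇒≡ᵇ-false l≢p = refl
  h-at : h p ≡ g p
  h-at rewrite ≡ᵇ-refl p = refl
  h≗g : ∀ l → i ≤ l → l < j → l ≢ r → h l ≡ g l
  h≗g l i≤l l<j l≢r with l ≟ p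
  ... | yes refl = h-at
  ... | no l≢p   = trans (h-off l l≢p) (f≗g l i≤l l<j l≢p l≢r)
  swap : ∀ (A u v : ℤ) → A +ℤ u +ℤ v ≡ A +ℤ v +ℤ u
  swap = solve-∀

-- Points of U

AgreeOff : Point → Point → ℕ → ℕ → Set
AgreeOff x y i j = ∀ p q → (p ≡ i → q ≡ j → ⊥) → x p q ≡ y p q

set : Point → ℕ → ℕ → ℤ → Point
set x i j v p q = if (p ≡ᵇ i) ∧ (q ≡ᵇ j) then v else x p q

set-same : ∀ x i j v → set x i j v i j ≡ v
set-same x i j v rewrite ≡ᵇ-refl i | ≡ᵇ-refl j = refl

set-agreeOff : ∀ x i j v → AgreeOff (set x i j v) x i j
set-agreeOff x i j v p q pq≢ij with p ≟ i
... | no p≢i   rewrite ≢⇒≡ᵇ-false p≢i = refl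
... | yes refl rewrite ≡ᵇ-refl p | ≢⇒≡ᵇ-false (pq≢ij refl) = refl

agreeOff-sym : ∀ {x y i j} → AgreeOff x y i j → AgreeOff y x i j
agreeOff-sym x≈y p q pq≢ij = sym (x≈y p q pq≢ij)

flow : ℕ → Point → ℕ → ℤ
flow n x m = ∑ (x m) (suc m) (suc n) - ∑ (λ l → x l m) 1 m

bSum≡∑ : ∀ n x → bSum n x ≡ ∑ (λ i → ∑ (x i) (suc i) (suc n)) 1 (suc n)
bSum≡∑ n x = sumℤ-concatMap (λ i → map (x i) (range (suc i) (suc n))) (range 1 (suc n))

module _ {x y : Point} {i j : ℕ} (x≈y : AgreeOff x y i j) where

  private
    δ : ℤ
    δ = x i j - y i j

    row-i : ∀ {k} → i < j → j < k → ∑ (x i) (suc i) k ≡ ∑ (y i) (suc i) k +ℤ δ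
    row-i i<j j<k = ∑-update (x i) (y i) j i<j j<k (λ l _ _ l≢j → x≈y i l (λ _ → l≢j))

  S-agreeOff-same : i < j → S x i j ≡ S y i j +ℤ δ
  S-agreeOff-same i<j = begin
    ∑ (x i) (suc i) (suc j) +ℤ ∑ (λ k → x k j) (suc i) j         ≡⟨ cong₂ _+ℤ_ (row-i i<j ≤-refl) column ⟩
    ∑ (y i) (suc i) (suc j) +ℤ δ +ℤ ∑ (λ k → y k j) (suc i) j    ≡⟨ swap (∑ (y i) (suc i) (suc j)) δ _ ⟩
    S y i j +ℤ δ                                                 ∎
    where
    column : ∑ (λ k → x k j) (suc i) j ≡ ∑ (λ k → y k j) (suc i) j
    column = ∑-cong _ _ (suc i) j (λ l i<l _ → x≈y l j (λ l≡i _ → <⇒≢ i<l (sym l≡i)))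
    swap : ∀ (A u v : ℤ) → A +ℤ u +ℤ v ≡ A +ℤ v +ℤ u
    swap = solve-∀

  S-agreeOff-other : ∀ p q → (p ≡ i → q < j) → (q ≡ j → i < p) → S x p q ≡ S y p q
  S-agreeOff-other p q sameStart sameEnd = cong₂ _+ℤ_
    (∑-cong (x p) (y p) (suc p) (suc q) (λ l _ l≤q → x≈y p l (λ p≡i l≡j →
      <-irrefl l≡j (≤-<-trans (s≤s⁻¹ l≤q) (sameStart p≡i)))))
    (∑-cong (λ k → x k q) (λ k → y k q) (suc p) q (λ l p<l _ → x≈y l q (λ l≡i q≡j →
      <-irrefl (sym l≡i) (<-trans (sameEnd q≡j) p<l))))

  flow-agreeOff-start : ∀ n → i < j → j ≤ n → flow n x i ≡ flow n y i +ℤ δ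
  flow-agreeOff-start n i<j j≤n = begin
    ∑ (x i) (suc i) (suc n) - ∑ (λ l → x l i) 1 i         ≡⟨ cong₂ _-_ (row-i i<j (s≤s j≤n)) column ⟩
    ∑ (y i) (suc i) (suc n) +ℤ δ - ∑ (λ l → y l i) 1 i    ≡⟨ shift (∑ (y i) (suc i) (suc n)) _ δ ⟩
    flow n y i +ℤ δ                                       ∎
    where
    column : ∑ (λ l → x l i) 1 i ≡ ∑ (λ l → y l i) 1 i
    column = ∑-cong _ _ 1 i (λ l _ l<i → x≈y l i (λ _ i≡j → <⇒≢ i<j i≡j))
    shift : ∀ (A B d : ℤ) → A +ℤ d - B ≡ A - B +ℤ d
    shift = solve-∀

  flow-agreeOff-end : ∀ n → 1 ≤ i → i < j → flow n x j ≡ flow n y j - δ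
  flow-agreeOff-end n 1≤i i<j = begin
    ∑ (x j) (suc j) (suc n) - ∑ (λ l → x l j) 1 j          ≡⟨ cong₂ _-_ row column ⟩
    ∑ (y j) (suc j) (suc n) - (∑ (λ l → y l j) 1 j +ℤ δ)   ≡⟨ shift (∑ (y j) (suc j) (suc n)) _ δ ⟩
    flow n y j - δ                                         ∎
    where
    row : ∑ (x j) (suc j) (suc n) ≡ ∑ (y j) (suc j) (suc n)
    row = ∑-cong _ _ (suc j) (suc n) (λ l _ _ → x≈y j l (λ j≡i _ → <⇒≢ i<j (sym j≡i)))
    column : ∑ (λ l → x l j) 1 j ≡ ∑ (λ l → y l j) 1 j +ℤ δ
    column = ∑-update (λ l → x l j) (λ l → y l j) i 1≤i i<j (λ l _ _ l≢i → x≈y l j (λ l≡i _ → l≢i l≡i))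
    shift : ∀ (A B d : ℤ) → A - (B +ℤ d) ≡ A - B - d
    shift = solve-∀

  flow-agreeOff-other : ∀ n m → m ≢ i → m ≢ j → flow n x m ≡ flow n y m
  flow-agreeOff-other n m m≢i m≢j = cong₂ _-_
    (∑-cong (x m) (y m) (suc m) (suc n) (λ l _ _ → x≈y m l (λ m≡i _ → m≢i m≡i)))
    (∑-cong (λ l → x l m) (λ l → y l m) 1 m (λ l _ _ → x≈y l m (λ _ m≡j → m≢j m≡j)))

  bSum-agreeOff : ∀ n → 1 ≤ i → i < j → j ≤ n → bSum n x ≡ bSum n y +ℤ δ
  bSum-agreeOff n 1≤i i<j j≤n = begin
    bSum n x                       ≡⟨ bSum≡∑ n x ⟩
    ∑ rowx 1 (suc n)               ≡⟨ ∑-update rowx rowy i 1≤i (s≤s (≤-trans (<⇒≤ i<j) j≤n)) other-rows ⟩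
    ∑ rowy 1 (suc n) +ℤ (rowx i - rowy i)
      ≡⟨ cong₂ _+ℤ_ (sym (bSum≡∑ n y)) (cong (_- rowy i) (row-i i<j (s≤s j≤n))) ⟩
    bSum n y +ℤ (rowy i +ℤ δ - rowy i) ≡⟨ cong (bSum n y +ℤ_) (cancel (rowy i) δ) ⟩
    bSum n y +ℤ δ                  ∎
    where
    rowx rowy : ℕ → ℤ
    rowx k = ∑ (x k) (suc k) (suc n)
    rowy k = ∑ (y k) (suc k) (suc n)
    other-rows : ∀ k → 1 ≤ k → k < suc n → k ≢ i → rowx k ≡ rowy k
    other-rows k _ _ k≢i = ∑-cong (x k) (y k) (suc k) (suc n) (λ l _ _ → x≈y k l (λ k≡i _ → k≢i k≡i))
    cancel : ∀ (A d : ℤ) → A +ℤ d - A ≡ d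
    cancel = solve-∀

-- Lists of segments and their products of transpositions

transp-left : ∀ a b → transp a b a ≡ b
transp-left a b rewrite ≡ᵇ-refl a = refl

transp-right : ∀ a b → a ≢ b → transp a b b ≡ a
transp-right a b a≢b rewrite ≢⇒≡ᵇ-false (≢-sym a≢b) | ≡ᵇ-refl b = refl

transp-fix : ∀ a b k → k ≢ a → k ≢ b → transp a b k ≡ k
transp-fix a b k k≢a k≢b rewrite ≢⇒≡ᵇ-false k≢a | ≢⇒≡ᵇ-false k≢b = refl

transp-involutive : ∀ a b k → transp a b (transp a b k) ≡ k
transp-involutive a b k with k ≟ a | k ≟ b
... | yes refl | _ with a ≟ b
...   | yes refl = trans (cong (transp a a) (transp-left a a)) (transp-left a a)
...   | no a≢b   = trans (cong (transp a b) (transp-left a b)) (transp-right a b a≢b)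
transp-involutive a b k | no k≢a | yes refl =
  trans (cong (transp a k) (transp-right a k (≢-sym k≢a))) (transp-left a k)
transp-involutive a b k | no k≢a | no k≢b =
  trans (cong (transp a b) (transp-fix a b k k≢a k≢b)) (transp-fix a b k k≢a k≢b)

Seg : Set
Seg = ℕ × ℕ

≟-seg : ∀ p q i j → (p ≡ i × q ≡ j) ⊎ (p ≡ i → q ≡ j → ⊥)
≟-seg p q i j with p ≟ i | q ≟ j
... | yes p≡i | yes q≡j = inj₁ (p≡i , q≡j)
... | yes _   | no q≢j  = inj₂ (λ _ q≡j → q≢j q≡j)
... | no p≢i  | _       = inj₂ (λ p≡i _ → p≢i p≡i)

member : List Seg → SegSet
member []             i j = false
member ((p , q) ∷ rs) i j = ((i ≡ᵇ p) ∧ (j ≡ᵇ q)) ∨ member rs i j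

member-here : ∀ i j rs → member ((i , j) ∷ rs) i j ≡ true
member-here i j rs rewrite ≡ᵇ-refl i | ≡ᵇ-refl j = refl

member-there : ∀ s rs p q → member rs p q ≡ true → member (s ∷ rs) p q ≡ true
member-there (i , j) rs p q ∈rs rewrite ∈rs with (p ≡ᵇ i) ∧ (q ≡ᵇ j)
... | true  = refl
... | false = refl

member-skip : ∀ i j rs p q → (p ≡ i → q ≡ j → ⊥) → member ((i , j) ∷ rs) p q ≡ member rs p q
member-skip i j rs p q pq≢ij with p ≟ i
... | no p≢i   rewrite ≢⇒≡ᵇ-false p≢i = refl
... | yes refl rewrite ≡ᵇ-refl p | ≢⇒≡ᵇ-false (pq≢ij refl) = refl

member-All : ∀ {P : Seg → Set} rs p q → All P rs → member rs p q ≡ true → P (p , q)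
member-All ((i , j) ∷ rs) p q (Pij ∷ Prs) ∈rs with p ≟ i | q ≟ j
... | yes refl | yes refl = Pij
... | yes refl | no q≢j rewrite member-skip p j rs p q (λ _ → q≢j) = member-All rs p q Prs ∈rs
... | no p≢i   | _      rewrite member-skip i j rs p q (λ p≡i _ → p≢i p≡i) = member-All rs p q Prs ∈rs

perm : List Seg → ℕ → ℕ
perm []             m = m
perm ((p , q) ∷ rs) m = transp p q (perm rs m)

perm⁻¹ : List Seg → ℕ → ℕ
perm⁻¹ []             m = m
perm⁻¹ ((p , q) ∷ rs) m = perm⁻¹ rs (transp p q m)

perm∘perm⁻¹ : ∀ rs m → perm rs (perm⁻¹ rs m) ≡ m
perm∘perm⁻¹ []             m = refl
perm∘perm⁻¹ ((p , q) ∷ rs) m =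
  trans (cong (transp p q) (perm∘perm⁻¹ rs (transp p q m))) (transp-involutive p q m)

perm⁻¹∘perm : ∀ rs m → perm⁻¹ rs (perm rs m) ≡ m
perm⁻¹∘perm []             m = refl
perm⁻¹∘perm ((p , q) ∷ rs) m = trans (cong (perm⁻¹ rs) (transp-involutive p q (perm rs m))) (perm⁻¹∘perm rs m)

-- q + i < j + p says that [p,q] is shorter than [i,j], without truncated subtraction.
Precedes : ℕ → ℕ → Seg → Set
Precedes i j (p , q) = ((q + i < j + p) ⊎ (q + i ≡ j + p × p < i)) × q ≢ i × p ≢ j

precedes-sameStart : ∀ {i j p q} → Precedes i j (p , q) → p ≡ i → q < j
precedes-sameStart {i} {j} {p} {q} (inj₁ shorter , _) refl = +-cancelʳ-< p q j shorter
precedes-sameStart (inj₂ (_ , p<i) , _) refl = ⊥-elim (<-irrefl refl p<i)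

precedes-sameEnd : ∀ {i j p q} → Precedes i j (p , q) → q ≡ j → i < p
precedes-sameEnd {i} {j} {p} {q} (inj₁ shorter , _) refl = +-cancelˡ-< q i p shorter
precedes-sameEnd {i} {j} {p} {q} (inj₂ (sameLength , p<i) , _) refl =
  ⊥-elim (<-irrefl (+-cancelˡ-≡ q p i (sym sameLength)) p<i)

Admissible : ℕ → List Seg → Set
Admissible n []             = ⊤
Admissible n ((i , j) ∷ rs) = (1 ≤ i × i < j × j ≤ n) × All (Precedes i j) rs × Admissible n rs

_∈[_,_] : ℕ → ℕ → ℕ → Set
m ∈[ i , j ] = i ≤ m × m ≤ j

Localised : List Seg → Set
Localised rs = ∀ m → perm⁻¹ rs m ≡ m ⊎
  Σ ℕ λ p → Σ ℕ λ q → member rs p q ≡ true × (m ≡ p ⊎ m ≡ q) × perm⁻¹ rs m ∈[ p , q ]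

module _ {i j : ℕ} {rs : List Seg} (i<j : i < j) (rs≺ij : All (Precedes i j) rs) (loc : Localised rs) where

  perm⁻¹-start-within : perm⁻¹ rs i ∈[ i , j ]
  perm⁻¹-start-within with loc i
  ... | inj₁ fixed = subst (_∈[ i , j ]) (sym fixed) (≤-refl , <⇒≤ i<j)
  ... | inj₂ (p , q , ∈rs , inj₂ i≡q , _) = ⊥-elim (proj₁ (proj₂ (member-All rs p q rs≺ij ∈rs)) (sym i≡q))
  ... | inj₂ (p , q , ∈rs , inj₁ i≡p , p≤m , m≤q) =
    ≤-trans (≤-reflexive i≡p) p≤m , ≤-trans m≤q (<⇒≤ (precedes-sameStart (member-All rs p q rs≺ij ∈rs) (sym i≡p)))

  perm⁻¹-end-within : perm⁻¹ rs j ∈[ i , j ]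
  perm⁻¹-end-within with loc j
  ... | inj₁ fixed = subst (_∈[ i , j ]) (sym fixed) (<⇒≤ i<j , ≤-refl)
  ... | inj₂ (p , q , ∈rs , inj₁ j≡p , _) = ⊥-elim (proj₂ (proj₂ (member-All rs p q rs≺ij ∈rs)) (sym j≡p))
  ... | inj₂ (p , q , ∈rs , inj₂ j≡q , p≤m , m≤q) =
    <⇒≤ (<-≤-trans (precedes-sameEnd (member-All rs p q rs≺ij ∈rs) (sym j≡q)) p≤m) , ≤-trans m≤q (≤-reflexive (sym j≡q))

admissible⇒localised : ∀ n rs → Admissible n rs → Localised rs
admissible⇒localised n []                   _                      m = inj₁ refl
admissible⇒localised n ((i , j) ∷ rs) ((_ , i<j , _) , rs≺ij , adm) m with m ≟ i | m ≟ j
... | yes refl | _ rewrite transp-left m j =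
  inj₂ (m , j , member-here m j rs , inj₁ refl , perm⁻¹-end-within i<j rs≺ij loc)
  where loc = admissible⇒localised n rs adm
... | no _ | yes refl rewrite transp-right i m (<⇒≢ i<j) =
  inj₂ (i , m , member-here i m rs , inj₂ refl , perm⁻¹-start-within i<j rs≺ij loc)
  where loc = admissible⇒localised n rs adm
... | no m≢i | no m≢j rewrite transp-fix i j m m≢i m≢j with admissible⇒localised n rs adm m
...   | inj₁ fixed = inj₁ fixed
...   | inj₂ (p , q , ∈rs , endpoint , within) = inj₂ (p , q , member-there (i , j) rs p q ∈rs , endpoint , within)

-- Solving for x along an admissible list

+lam-split : ∀ a n m k → m ≤ k → k ≤ n → + lam a n m ≡ + aSum a m k +ℤ + lam a n k
+lam-split a n m k m≤k k≤n = begin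
  + lam a n m                               ≡⟨ +-sum a (range m n) ⟩
  ∑ (λ z → + a z) m n                       ≡⟨ ∑-split (λ z → + a z) m≤k k≤n ⟩
  ∑ (λ z → + a z) m k +ℤ ∑ (λ z → + a z) k n ≡⟨ cong₂ _+ℤ_ (+-sum a (range m k)) (+-sum a (range k n)) ⟨
  + aSum a m k +ℤ + lam a n k               ∎

lam-antitone : ∀ a n m k → m ≤ k → k ≤ n → lam a n k ≤ lam a n m
lam-antitone a n m k m≤k k≤n = subst (lam a n k ≤_) split (m≤n+m (lam a n k) (aSum a m k))
  where
  split : aSum a m k + lam a n k ≡ lam a n m
  split = ℤP.+-injective (sym (trans (+lam-split a n m k m≤k k≤n) (sym (ℤP.pos-+ (aSum a m k) (lam a n k)))))

n≤m⇒+∣m-n∣≡+m-+n : ∀ {m n} → n ≤ m → + ∣ m - n ∣ ≡ + m - + n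
n≤m⇒+∣m-n∣≡+m-+n {m} {n} n≤m = begin
  + ∣ m - n ∣   ≡⟨ cong +_ (m≤n⇒∣n-m∣≡n∸m n≤m) ⟩
  + (m ∸ n)     ≡⟨ ℤP.⊖-≥ n≤m ⟨
  m ⊖ n         ≡⟨ ℤP.[+m]-[+n]≡m⊖n m n ⟨
  + m - + n     ∎

n≤m⇒+∣n-m∣≡+m-+n : ∀ {m n} → n ≤ m → + ∣ n - m ∣ ≡ + m - + n
n≤m⇒+∣n-m∣≡+m-+n {m} {n} n≤m = trans (cong +_ (∣-∣-comm n m)) (n≤m⇒+∣m-n∣≡+m-+n n≤m)

IsXEAt : (ℕ → ℕ) → SegSet → Point → ℕ → ℕ → Set
IsXEAt a E x p q = (E p q ≡ false → x p q ≡ + 0) × (E p q ≡ true → S x p q ≡ + aSum a p q)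

IsXEAt-cong : ∀ {a E E' x y p q} → E p q ≡ E' p q → x p q ≡ y p q → (E p q ≡ true → S x p q ≡ S y p q) →
  IsXEAt a E x p q → IsXEAt a E' y p q
IsXEAt-cong E≡E' x≡y Sx≡Sy (vanish , equation) =
  (λ ∉E' → trans (sym x≡y) (vanish (trans E≡E' ∉E'))) ,
  (λ ∈E' → trans (sym (Sx≡Sy (trans E≡E' ∈E'))) (equation (trans E≡E' ∈E')))

IsXE-cong : ∀ {n a E E' x} → (∀ p q → E p q ≡ E' p q) → IsXE n a E x → IsXE n a E' x
IsXE-cong {E = E} {E'} {x} E≡E' hx p q 1≤p p<q q≤n =
  IsXEAt-cong {E = E} {E'} {x} {x} (E≡E' p q) refl (λ _ → refl) (hx p q 1≤p p<q q≤n)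

module ForSegments (n : ℕ) (a : ℕ → ℕ) where

  Λ : ℕ → ℤ
  Λ m = + lam a n m

  +aSum≡Λ-Λ : ∀ {i j} → i ≤ j → j ≤ n → + aSum a i j ≡ Λ i - Λ j
  +aSum≡Λ-Λ {i} {j} i≤j j≤n = begin
    + aSum a i j                     ≡⟨ cancel (+ aSum a i j) (Λ j) ⟨
    + aSum a i j +ℤ Λ j - Λ j        ≡⟨ cong (_- Λ j) (+lam-split a n i j i≤j j≤n) ⟨
    Λ i - Λ j                        ∎
    where
    cancel : ∀ (d v : ℤ) → d +ℤ v - v ≡ d
    cancel = solve-∀

  +∣lam-lam∣ : ∀ {m k} → m ≤ k → k ≤ n → + ∣ lam a n m - lam a n k ∣ ≡ Λ m - Λ k
  +∣lam-lam∣ {m} {k} m≤k k≤n = n≤m⇒+∣m-n∣≡+m-+n (lam-antitone a n m k m≤k k≤n)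

  +∣lam-lam∣′ : ∀ {m k} → m ≤ k → k ≤ n → + ∣ lam a n k - lam a n m ∣ ≡ Λ m - Λ k
  +∣lam-lam∣′ {m} {k} m≤k k≤n = n≤m⇒+∣n-m∣≡+m-+n (lam-antitone a n m k m≤k k≤n)

  displacement : List Seg → ℤ
  displacement rs = ∑ (λ m → + ∣ lam a n m - lam a n (perm rs m) ∣) 1 (suc n)

  FlowInvariant : List Seg → Point → Set
  FlowInvariant rs x = ∀ m → 1 ≤ m → m ≤ n → flow n x m ≡ Λ m - Λ (perm⁻¹ rs m)

  Invariant : List Seg → Point → Set
  Invariant rs x = FlowInvariant rs x × (+ 2 *ℤ bSum n x ≡ displacement rs)

  module _ {rs : List Seg} {x : Point} (hx : IsXE n a (member rs) x) {i j : ℕ}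
           (rs≺ij : All (Precedes i j) rs) (1≤i : 1 ≤ i) (i<j : i < j) (j≤n : j ≤ n) where

    private
      vanishes : ∀ p q → 1 ≤ p → p < q → q ≤ n → (member rs p q ≡ true → ⊥) → x p q ≡ + 0
      vanishes p q 1≤p p<q q≤n ∉rs = proj₁ (hx p q 1≤p p<q q≤n) (¬-not ∉rs)

      precedes : ∀ {p q} → member rs p q ≡ true → Precedes i j (p , q)
      precedes {p} {q} = member-All rs p q rs≺ij

      1≤j : 1 ≤ j
      1≤j = ≤-trans 1≤i (<⇒≤ i<j)

      i≤n : i ≤ n
      i≤n = ≤-trans (<⇒≤ i<j) j≤n

    -- Segments of rs never leave i to the right of j, enter i, or leave j, and enter j only from the right of i.
    flow-start : flow n x i ≡ ∑ (x i) (suc i) (suc j)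
    flow-start = begin
      ∑ (x i) (suc i) (suc n) - ∑ (λ l → x l i) 1 i
        ≡⟨ cong₂ _-_ (∑-split (x i) (s≤s (<⇒≤ i<j)) (s≤s j≤n)) noInflow ⟩
      ∑ (x i) (suc i) (suc j) +ℤ ∑ (x i) (suc j) (suc n) - + 0
        ≡⟨ cong (λ u → ∑ (x i) (suc i) (suc j) +ℤ u - + 0) noLongOutflow ⟩
      ∑ (x i) (suc i) (suc j) +ℤ + 0 - + 0
        ≡⟨ ℤP.+-identityʳ _ ⟩
      ∑ (x i) (suc i) (suc j) +ℤ + 0
        ≡⟨ ℤP.+-identityʳ _ ⟩
      ∑ (x i) (suc i) (suc j) ∎
      where
      noLongOutflow : ∑ (x i) (suc j) (suc n) ≡ + 0
      noLongOutflow = ∑-zero (x i) (suc j) (suc n) λ l j<l l≤n → vanishes i l 1≤i (<-trans i<j j<l) (s≤s⁻¹ l≤n)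
        λ ∈rs → <-asym j<l (precedes-sameStart (precedes ∈rs) refl)
      noInflow : ∑ (λ l → x l i) 1 i ≡ + 0
      noInflow = ∑-zero (λ l → x l i) 1 i λ l 1≤l l<i → vanishes l i 1≤l l<i i≤n
        λ ∈rs → proj₁ (proj₂ (precedes ∈rs)) refl

    flow-end : flow n x j ≡ - ∑ (λ l → x l j) (suc i) j
    flow-end = begin
      ∑ (x j) (suc j) (suc n) - ∑ (λ l → x l j) 1 j
        ≡⟨ cong₂ _-_ noOutflow (∑-split (λ l → x l j) (s≤s z≤n) i<j) ⟩
      + 0 - (∑ (λ l → x l j) 1 (suc i) +ℤ ∑ (λ l → x l j) (suc i) j)
        ≡⟨ cong (λ u → + 0 - (u +ℤ ∑ (λ l → x l j) (suc i) j)) noShortInflow ⟩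
      + 0 - (+ 0 +ℤ ∑ (λ l → x l j) (suc i) j)
        ≡⟨ ℤP.+-identityˡ _ ⟩
      - (+ 0 +ℤ ∑ (λ l → x l j) (suc i) j)
        ≡⟨ cong -_ (ℤP.+-identityˡ _) ⟩
      - ∑ (λ l → x l j) (suc i) j ∎
      where
      noOutflow : ∑ (x j) (suc j) (suc n) ≡ + 0
      noOutflow = ∑-zero (x j) (suc j) (suc n) λ l j<l l≤n → vanishes j l 1≤j j<l (s≤s⁻¹ l≤n)
        λ ∈rs → proj₂ (proj₂ (precedes ∈rs)) refl
      noShortInflow : ∑ (λ l → x l j) 1 (suc i) ≡ + 0
      noShortInflow = ∑-zero (λ l → x l j) 1 (suc i) λ l 1≤l l≤i → vanishes l j 1≤l (≤-<-trans (s≤s⁻¹ l≤i) i<j) j≤n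
        λ ∈rs → <-irrefl refl (≤-<-trans (s≤s⁻¹ l≤i) (precedes-sameEnd (precedes ∈rs) refl))

    S≡flow-flow : S x i j ≡ flow n x i - flow n x j
    S≡flow-flow = begin
      ∑ (x i) (suc i) (suc j) +ℤ ∑ (λ k → x k j) (suc i) j                    ≡⟨ negneg (∑ (x i) (suc i) (suc j)) (∑ (λ k → x k j) (suc i) j) ⟩
      ∑ (x i) (suc i) (suc j) - - ∑ (λ k → x k j) (suc i) j                 ≡⟨ cong₂ _-_ flow-start flow-end ⟨
      flow n x i - flow n x j                                                  ∎
      where
      negneg : ∀ (A B : ℤ) → A +ℤ B ≡ A - - B
      negneg = solve-∀

  -- Prepending (i j) changes only the terms at m₁ = perm⁻¹ i and m₂ = perm⁻¹ j; as both lie in [i,j]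
  -- and λ is antitone, the four absolute values involved can be resolved.
  displacement-cons : ∀ {i j rs} → 1 ≤ i → i < j → j ≤ n → All (Precedes i j) rs → Localised rs →
    displacement ((i , j) ∷ rs) ≡ displacement rs +ℤ + 2 *ℤ (Λ (perm⁻¹ rs i) - Λ (perm⁻¹ rs j))
  displacement-cons {i} {j} {rs} 1≤i i<j j≤n rs≺ij loc = begin
    ∑ new 1 (suc n)
      ≡⟨ ∑-update₂ new old m₁ m₂ m₁≢m₂ (≤-trans 1≤i i≤m₁) (s≤s (≤-trans m₁≤j j≤n))
                                     (≤-trans 1≤i i≤m₂) (s≤s (≤-trans m₂≤j j≤n)) unchanged ⟩
    ∑ old 1 (suc n) +ℤ (new m₁ - old m₁) +ℤ (new m₂ - old m₂)
      ≡⟨ ℤP.+-assoc (∑ old 1 (suc n)) _ _ ⟩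
    displacement rs +ℤ ((new m₁ - old m₁) +ℤ (new m₂ - old m₂))
      ≡⟨ cong (displacement rs +ℤ_) (cong₂ _+ℤ_ (cong₂ _-_ new-m₁ old-m₁) (cong₂ _-_ new-m₂ old-m₂)) ⟩
    displacement rs +ℤ ((Λ m₁ - Λ j - (Λ i - Λ m₁)) +ℤ (Λ i - Λ m₂ - (Λ m₂ - Λ j)))
      ≡⟨ cong (displacement rs +ℤ_) (collect (Λ i) (Λ j) (Λ m₁) (Λ m₂)) ⟩
    displacement rs +ℤ + 2 *ℤ (Λ m₁ - Λ m₂) ∎
    where
    m₁ m₂ : ℕ
    m₁ = perm⁻¹ rs i
    m₂ = perm⁻¹ rs j
    i≤m₁ : i ≤ m₁
    i≤m₁ = proj₁ (perm⁻¹-start-within i<j rs≺ij loc)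
    m₁≤j : m₁ ≤ j
    m₁≤j = proj₂ (perm⁻¹-start-within i<j rs≺ij loc)
    i≤m₂ : i ≤ m₂
    i≤m₂ = proj₁ (perm⁻¹-end-within i<j rs≺ij loc)
    m₂≤j : m₂ ≤ j
    m₂≤j = proj₂ (perm⁻¹-end-within i<j rs≺ij loc)
    new old : ℕ → ℤ
    new m = + ∣ lam a n m - lam a n (perm ((i , j) ∷ rs) m) ∣
    old m = + ∣ lam a n m - lam a n (perm rs m) ∣
    m₁≢m₂ : m₁ ≢ m₂
    m₁≢m₂ m₁≡m₂ = <⇒≢ i<j (trans (sym (perm∘perm⁻¹ rs i)) (trans (cong (perm rs) m₁≡m₂) (perm∘perm⁻¹ rs j)))
    unchanged : ∀ l → 1 ≤ l → l < suc n → l ≢ m₁ → l ≢ m₂ → new l ≡ old l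
    unchanged l _ _ l≢m₁ l≢m₂ = cong (λ z → + ∣ lam a n l - lam a n z ∣)
      (transp-fix i j (perm rs l) (λ e → l≢m₁ (trans (sym (perm⁻¹∘perm rs l)) (cong (perm⁻¹ rs) e)))
                                  (λ e → l≢m₂ (trans (sym (perm⁻¹∘perm rs l)) (cong (perm⁻¹ rs) e))))
    new-m₁ : new m₁ ≡ Λ m₁ - Λ j
    new-m₁ rewrite perm∘perm⁻¹ rs i | transp-left i j = +∣lam-lam∣ m₁≤j j≤n
    old-m₁ : old m₁ ≡ Λ i - Λ m₁
    old-m₁ rewrite perm∘perm⁻¹ rs i = +∣lam-lam∣′ i≤m₁ (≤-trans m₁≤j j≤n)
    new-m₂ : new m₂ ≡ Λ i - Λ m₂
    new-m₂ rewrite perm∘perm⁻¹ rs j | transp-right i j (<⇒≢ i<j) = +∣lam-lam∣′ i≤m₂ (≤-trans m₂≤j j≤n)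
    old-m₂ : old m₂ ≡ Λ m₂ - Λ j
    old-m₂ rewrite perm∘perm⁻¹ rs j = +∣lam-lam∣ m₂≤j j≤n
    collect : ∀ (Li Lj L₁ L₂ : ℤ) → (L₁ - Lj - (Li - L₁)) +ℤ (Li - L₂ - (L₂ - Lj)) ≡ + 2 *ℤ (L₁ - L₂)
    collect = solve-∀

  module _ {i j : ℕ} {rs : List Seg} {x y : Point} (rs≺ij : All (Precedes i j) rs) (x≈y : AgreeOff x y i j)
           {p q : ℕ} (pq≢ij : p ≡ i → q ≡ j → ⊥) where

    private
      same-membership : member ((i , j) ∷ rs) p q ≡ member rs p q
      same-membership = member-skip i j rs p q pq≢ij

      same-S : member rs p q ≡ true → S x p q ≡ S y p q
      same-S ∈rs = S-agreeOff-other x≈y p q (precedes-sameStart pq≺ij) (precedes-sameEnd pq≺ij)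
        where
        pq≺ij : Precedes i j (p , q)
        pq≺ij = member-All rs p q rs≺ij ∈rs

    IsXEAt-cons⁺ : IsXEAt a (member rs) y p q → IsXEAt a (member ((i , j) ∷ rs)) x p q
    IsXEAt-cons⁺ = IsXEAt-cong {E = member rs} {member ((i , j) ∷ rs)} {y} {x} (sym same-membership) (sym (x≈y p q pq≢ij)) (λ ∈rs → sym (same-S ∈rs))

    IsXEAt-cons⁻ : IsXEAt a (member ((i , j) ∷ rs)) x p q → IsXEAt a (member rs) y p q
    IsXEAt-cons⁻ = IsXEAt-cong {E = member ((i , j) ∷ rs)} {member rs} {x} {y} same-membership (x≈y p q pq≢ij) (λ ∈ijrs → same-S (trans (sym same-membership) ∈ijrs))

  IsXE-unset : ∀ {i j rs x} → All (Precedes i j) rs → IsXE n a (member ((i , j) ∷ rs)) x →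
    IsXE n a (member rs) (set x i j (+ 0))
  IsXE-unset {i} {j} {rs} {x} rs≺ij hx p q 1≤p p<q q≤n with ≟-seg p q i j
  ... | inj₁ (refl , refl) =
    (λ _ → set-same x p q (+ 0)) ,
    (λ ∈rs → ⊥-elim (<-irrefl refl (precedes-sameStart (member-All rs p q rs≺ij ∈rs) refl)))
  ... | inj₂ pq≢ij =
    IsXEAt-cons⁻ rs≺ij (agreeOff-sym (set-agreeOff x i j (+ 0))) pq≢ij (hx p q 1≤p p<q q≤n)

  -- Given the solution y for rs, the equation of the new segment [i,j] pins down the single new coordinate.
  S-after-cons : ∀ {i j rs x y} → IsXE n a (member rs) y → FlowInvariant rs y → All (Precedes i j) rs →
    1 ≤ i → i < j → j ≤ n → AgreeOff x y i j →
    S x i j ≡ + aSum a i j +ℤ ((x i j - y i j) - (Λ (perm⁻¹ rs i) - Λ (perm⁻¹ rs j)))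
  S-after-cons {i} {j} {rs} {x} {y} hy inv rs≺ij 1≤i i<j j≤n x≈y = begin
    S x i j                                        ≡⟨ S-agreeOff-same x≈y i<j ⟩
    S y i j +ℤ δ                                   ≡⟨ cong (_+ℤ δ) (S≡flow-flow hy rs≺ij 1≤i i<j j≤n) ⟩
    flow n y i - flow n y j +ℤ δ                   ≡⟨ cong (λ u → u +ℤ δ) (cong₂ _-_ (inv i 1≤i i≤n) (inv j 1≤j j≤n)) ⟩
    (Λ i - Λ m₁) - (Λ j - Λ m₂) +ℤ δ               ≡⟨ regroup (Λ i) (Λ j) (Λ m₁) (Λ m₂) δ ⟩
    (Λ i - Λ j) +ℤ (δ - (Λ m₁ - Λ m₂))             ≡⟨ cong (_+ℤ (δ - (Λ m₁ - Λ m₂))) (+aSum≡Λ-Λ (<⇒≤ i<j) j≤n) ⟨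
    + aSum a i j +ℤ (δ - (Λ m₁ - Λ m₂))            ∎
    where
    δ : ℤ
    δ = x i j - y i j
    m₁ m₂ : ℕ
    m₁ = perm⁻¹ rs i
    m₂ = perm⁻¹ rs j
    i≤n : i ≤ n
    i≤n = ≤-trans (<⇒≤ i<j) j≤n
    1≤j : 1 ≤ j
    1≤j = ≤-trans 1≤i (<⇒≤ i<j)
    regroup : ∀ (Li Lj L₁ L₂ d : ℤ) → (Li - L₁) - (Lj - L₂) +ℤ d ≡ (Li - Lj) +ℤ (d - (L₁ - L₂))
    regroup = solve-∀

  invariant-empty : ∀ x → IsXE n a (member []) x → Invariant [] x
  invariant-empty x hx = flows , twice-bSum
    where
    vanishes : ∀ p q → 1 ≤ p → p < q → q ≤ n → x p q ≡ + 0
    vanishes p q 1≤p p<q q≤n = proj₁ (hx p q 1≤p p<q q≤n) refl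
    flows : FlowInvariant [] x
    flows m 1≤m m≤n = begin
      ∑ (x m) (suc m) (suc n) - ∑ (λ l → x l m) 1 m
        ≡⟨ cong₂ _-_ (∑-zero (x m) (suc m) (suc n) (λ l m<l l≤n → vanishes m l 1≤m m<l (s≤s⁻¹ l≤n)))
                     (∑-zero (λ l → x l m) 1 m (λ l 1≤l l<m → vanishes l m 1≤l l<m m≤n)) ⟩
      + 0 - + 0    ≡⟨ ℤP.+-inverseʳ (Λ m) ⟨
      Λ m - Λ m    ∎
    twice-bSum : + 2 *ℤ bSum n x ≡ displacement []
    twice-bSum = begin
      + 2 *ℤ bSum n x
        ≡⟨ cong (+ 2 *ℤ_) (bSum≡∑ n x) ⟩
      + 2 *ℤ ∑ (λ i → ∑ (x i) (suc i) (suc n)) 1 (suc n)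
        ≡⟨ cong (+ 2 *ℤ_) (∑-zero _ 1 (suc n) λ i 1≤i _ →
             ∑-zero (x i) (suc i) (suc n) λ l i<l l≤n → vanishes i l 1≤i i<l (s≤s⁻¹ l≤n)) ⟩
      + 0
        ≡⟨ ∑-zero _ 1 (suc n) (λ m _ _ → cong +_ (∣n-n∣≡0 (lam a n m))) ⟨
      displacement [] ∎

  new-coordinate : ∀ {i j rs x y} → IsXE n a (member rs) y → FlowInvariant rs y → All (Precedes i j) rs →
    1 ≤ i → i < j → j ≤ n → AgreeOff x y i j → S x i j ≡ + aSum a i j →
    x i j - y i j ≡ Λ (perm⁻¹ rs i) - Λ (perm⁻¹ rs j)
  new-coordinate {i} {j} {rs} {x} {y} hy flows-y rs≺ij 1≤i i<j j≤n x≈y equation =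
    ℤP.i-j≡0⇒i≡j (x i j - y i j) _ (identityʳ-unique (+ aSum a i j) _
      (sym (trans (sym equation) (S-after-cons hy flows-y rs≺ij 1≤i i<j j≤n x≈y))))

  flowInvariant-cons : ∀ {i j rs x y} → 1 ≤ i → i < j → j ≤ n → AgreeOff x y i j →
    x i j - y i j ≡ Λ (perm⁻¹ rs i) - Λ (perm⁻¹ rs j) → FlowInvariant rs y → FlowInvariant ((i , j) ∷ rs) x
  flowInvariant-cons {i} {j} {rs} {x} {y} 1≤i i<j j≤n x≈y δ≡ flows-y m 1≤m m≤n with m ≟ i | m ≟ j
  ... | yes refl | _ rewrite transp-left m j = begin
    flow n x m                                   ≡⟨ flow-agreeOff-start x≈y n i<j j≤n ⟩
    flow n y m +ℤ (x m j - y m j)                ≡⟨ cong₂ _+ℤ_ (flows-y m 1≤m m≤n) δ≡ ⟩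
    Λ m - Λ m₁ +ℤ (Λ m₁ - Λ m₂)                  ≡⟨ ℤP.+-minus-telescope (Λ m) (Λ m₁) (Λ m₂) ⟩
    Λ m - Λ m₂                                   ∎
    where
    m₁ m₂ : ℕ
    m₁ = perm⁻¹ rs m
    m₂ = perm⁻¹ rs j
  ... | no _ | yes refl rewrite transp-right i m (<⇒≢ i<j) = begin
    flow n x m                                   ≡⟨ flow-agreeOff-end x≈y n 1≤i i<j ⟩
    flow n y m - (x i m - y i m)                 ≡⟨ cong₂ _-_ (flows-y m 1≤m m≤n) δ≡ ⟩
    Λ m - Λ m₂ - (Λ m₁ - Λ m₂)                   ≡⟨ cancel (Λ m) (Λ m₁) (Λ m₂) ⟩
    Λ m - Λ m₁                                   ∎
    where
    m₁ m₂ : ℕ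
    m₁ = perm⁻¹ rs i
    m₂ = perm⁻¹ rs m
    cancel : ∀ (L L₁ L₂ : ℤ) → L - L₂ - (L₁ - L₂) ≡ L - L₁
    cancel = solve-∀
  ... | no m≢i | no m≢j rewrite transp-fix i j m m≢i m≢j =
    trans (flow-agreeOff-other x≈y n m m≢i m≢j) (flows-y m 1≤m m≤n)

  twice-bSum-cons : ∀ {i j rs x y} → 1 ≤ i → i < j → j ≤ n → All (Precedes i j) rs → Localised rs →
    AgreeOff x y i j → x i j - y i j ≡ Λ (perm⁻¹ rs i) - Λ (perm⁻¹ rs j) →
    + 2 *ℤ bSum n y ≡ displacement rs → + 2 *ℤ bSum n x ≡ displacement ((i , j) ∷ rs)
  twice-bSum-cons {i} {j} {rs} {x} {y} 1≤i i<j j≤n rs≺ij loc x≈y δ≡ twice-bSum-y = begin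
    + 2 *ℤ bSum n x                             ≡⟨ cong (+ 2 *ℤ_) (bSum-agreeOff x≈y n 1≤i i<j j≤n) ⟩
    + 2 *ℤ (bSum n y +ℤ δ)                      ≡⟨ ℤP.*-distribˡ-+ (+ 2) (bSum n y) δ ⟩
    + 2 *ℤ bSum n y +ℤ + 2 *ℤ δ                 ≡⟨ cong₂ _+ℤ_ twice-bSum-y (cong (+ 2 *ℤ_) δ≡) ⟩
    displacement rs +ℤ + 2 *ℤ (Λ (perm⁻¹ rs i) - Λ (perm⁻¹ rs j))
                                                ≡⟨ displacement-cons 1≤i i<j j≤n rs≺ij loc ⟨
    displacement ((i , j) ∷ rs)                 ∎
    where
    δ : ℤ
    δ = x i j - y i j

  invariant : ∀ rs → Admissible n rs → ∀ x → IsXE n a (member rs) x → Invariant rs x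
  invariant []             _                             x hx = invariant-empty x hx
  invariant ((i , j) ∷ rs) ((1≤i , i<j , j≤n) , rs≺ij , adm) x hx =
    flowInvariant-cons {rs = rs} 1≤i i<j j≤n x≈y δ≡ flows-y ,
    twice-bSum-cons 1≤i i<j j≤n rs≺ij (admissible⇒localised n rs adm) x≈y δ≡ twice-bSum-y
    where
    y : Point
    y = set x i j (+ 0)
    hy : IsXE n a (member rs) y
    hy = IsXE-unset rs≺ij hx
    x≈y : AgreeOff x y i j
    x≈y = agreeOff-sym (set-agreeOff x i j (+ 0))
    flows-y : FlowInvariant rs y
    flows-y = proj₁ (invariant rs adm y hy)
    twice-bSum-y : + 2 *ℤ bSum n y ≡ displacement rs
    twice-bSum-y = proj₂ (invariant rs adm y hy)
    δ≡ : x i j - y i j ≡ Λ (perm⁻¹ rs i) - Λ (perm⁻¹ rs j)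
    δ≡ = new-coordinate hy flows-y rs≺ij 1≤i i<j j≤n x≈y (proj₂ (hx i j 1≤i i<j j≤n) (member-here i j rs))

  xE-exists : ∀ rs → Admissible n rs → Σ Point (IsXE n a (member rs))
  xE-exists []             _ = (λ _ _ → + 0) , λ _ _ _ _ _ → (λ _ → refl) , (λ ())
  xE-exists ((i , j) ∷ rs) ((1≤i , i<j , j≤n) , rs≺ij , adm) = x , hx
    where
    y : Point
    y = proj₁ (xE-exists rs adm)
    hy : IsXE n a (member rs) y
    hy = proj₂ (xE-exists rs adm)
    D : ℤ
    D = Λ (perm⁻¹ rs i) - Λ (perm⁻¹ rs j)
    x : Point
    x = set y i j D
    x≈y : AgreeOff x y i j
    x≈y = set-agreeOff y i j D
    yij≡0 : y i j ≡ + 0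
    yij≡0 = proj₁ (hy i j 1≤i i<j j≤n)
      (¬-not λ ∈rs → <-irrefl refl (precedes-sameStart (member-All rs i j rs≺ij ∈rs) refl))
    equation : S x i j ≡ + aSum a i j
    equation = begin
      S x i j                               ≡⟨ S-after-cons hy (proj₁ (invariant rs adm y hy)) rs≺ij 1≤i i<j j≤n x≈y ⟩
      + aSum a i j +ℤ ((x i j - y i j) - D) ≡⟨ cong (λ u → + aSum a i j +ℤ ((u - y i j) - D)) (set-same y i j D) ⟩
      + aSum a i j +ℤ ((D - y i j) - D)     ≡⟨ cong (λ u → + aSum a i j +ℤ ((D - u) - D)) yij≡0 ⟩
      + aSum a i j +ℤ ((D - + 0) - D)       ≡⟨ cong (+ aSum a i j +ℤ_) (cancel D) ⟩
      + aSum a i j +ℤ + 0                   ≡⟨ ℤP.+-identityʳ _ ⟩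
      + aSum a i j                          ∎
      where
      cancel : ∀ (d : ℤ) → (d - + 0) - d ≡ + 0
      cancel = solve-∀
    hx : IsXE n a (member ((i , j) ∷ rs)) x
    hx p q 1≤p p<q q≤n with ≟-seg p q i j
    ... | inj₁ (refl , refl) rewrite member-here p q rs = (λ ()) , (λ _ → equation)
    ... | inj₂ pq≢ij = IsXEAt-cons⁺ rs≺ij x≈y pq≢ij (hy p q 1≤p p<q q≤n)

-- Listing the segments of E in the order used by w

_<lex_ : ℕ × ℕ → ℕ × ℕ → Set
_<lex_ = ×-Lex _≡_ _<_ _<_

module Sweep (n : ℕ) (E : SegSet) (E∈Rp : InRp n E) where

  push : ℕ → List Seg → ℕ → List Seg
  push L acc p = if E p (p + L) then (p , p + L) ∷ acc else acc

  pass : List Seg → ℕ → List Seg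
  pass acc L = foldl (push L) acc (range 1 (suc n))

  segments : List Seg
  segments = foldl pass [] (range 1 n)

  perm-pass : ∀ L ps acc m →
    perm (foldl (push L) acc ps) m ≡ foldl (λ k p → if E p (p + L) then transp p (p + L) k else k) (perm acc m) ps
  perm-pass L []       acc m = refl
  perm-pass L (p ∷ ps) acc m = trans (perm-pass L ps (push L acc p) m) (cong (λ k → foldl _ k ps) perm-push)
    where
    perm-push : perm (push L acc p) m ≡ (if E p (p + L) then transp p (p + L) (perm acc m) else perm acc m)
    perm-push with E p (p + L)
    ... | true  = refl
    ... | false = refl

  perm-passes : ∀ Ls acc m → perm (foldl pass acc Ls) m ≡ foldl (λ k L → stepLen n E L k) (perm acc m) Ls
  perm-passes []       acc m = refl
  perm-passes (L ∷ Ls) acc m = trans (perm-passes Ls (pass acc L) m)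
    (cong (λ k → foldl (λ k L → stepLen n E L k) k Ls) (perm-pass L (range 1 (suc n)) acc m))

  perm-segments≡w : ∀ m → perm segments m ≡ w n E m
  perm-segments≡w = perm-passes (range 1 n) []

  inR : ∀ {p q} → E p q ≡ true → 1 ≤ p × p < q × q ≤ n
  inR {p} {q} = proj₁ E∈Rp p q

  length<n : ∀ {p q} → E p q ≡ true → q ∸ p < n
  length<n pq∈E with inR pq∈E
  ... | 1≤p , p<q , q≤n = <-≤-trans (∸-monoʳ-< 1≤p (<⇒≤ p<q)) q≤n

  -- [p,q] ∩ [q,d] = [q,q] would have to be a segment of E.
  no-touching : ∀ {p q d} → E p q ≡ true → E q d ≡ true → ⊥
  no-touching {p} {q} {d} pq∈E qd∈E =
    <-irrefl refl (subst₂ _<_ (m≤n⇒m⊔n≡n (<⇒≤ p<q)) (m≤n⇒m⊓n≡m (<⇒≤ q<d)) meet)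
    where
    p<q : p < q
    p<q = proj₁ (proj₂ (inR pq∈E))
    q<d : q < d
    q<d = proj₁ (proj₂ (inR qd∈E))
    meet : p ⊔ q < q ⊓ d
    meet = proj₁ (proj₂ E∈Rp p q q d pq∈E qd∈E
      (subst₂ _≤_ (sym (m≤n⇒m⊔n≡n (<⇒≤ p<q))) (sym (m≤n⇒m⊓n≡m (<⇒≤ q<d))) ≤-refl))

  -- (L , a) is the position of the sweep, which visits the segments [p, p + L'] in lexicographic order of (L', p).
  Visited : ℕ → ℕ → Seg → Set
  Visited L a (p , q) = E p q ≡ true × Σ ℕ λ L' → q ≡ p + L' × (L' , p) <lex (L , a)

  Complete : ℕ → ℕ → List Seg → Set
  Complete L a acc = ∀ p L' → (L' , p) <lex (L , a) → E p (p + L') ≡ true → member acc p (p + L') ≡ true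

  SweptUpTo : ℕ → ℕ → List Seg → Set
  SweptUpTo L a acc = Admissible n acc × All (Visited L a) acc × Complete L a acc

  visited-suc : ∀ {L a} t → Visited L a t → Visited L (suc a) t
  visited-suc _ (∈E , L' , q≡ , inj₁ L'<L)           = ∈E , L' , q≡ , inj₁ L'<L
  visited-suc _ (∈E , L' , q≡ , inj₂ (L'≡L , p<a))   = ∈E , L' , q≡ , inj₂ (L'≡L , m<n⇒m<1+n p<a)

  visited⇒precedes : ∀ {L a} t → E a (a + L) ≡ true → Visited L a t → Precedes a (a + L) t
  visited⇒precedes {L} {a} (p , .(p + L')) new∈E (∈E , L' , refl , earlier) =
    lengthOrder earlier , (λ { refl → no-touching ∈E new∈E }) , (λ { refl → no-touching new∈E ∈E })
    where
    swap-ends : ∀ u v w → u + v + w ≡ w + v + u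
    swap-ends = ℕ-Solver.solve-∀
    lengthOrder : (L' , p) <lex (L , a) → (p + L' + a < a + L + p) ⊎ (p + L' + a ≡ a + L + p × p < a)
    lengthOrder (inj₁ L'<L)         = inj₁ (subst (p + L' + a <_) (swap-ends p L a) (+-monoˡ-< a (+-monoʳ-< p L'<L)))
    lengthOrder (inj₂ (refl , p<a)) = inj₂ (swap-ends p L a , p<a)

  lex-suc : ∀ {L a L' p} → (L' , p) <lex (L , suc a) → (L' , p) <lex (L , a) ⊎ (L' ≡ L × p ≡ a)
  lex-suc (inj₁ L'<L) = inj₁ (inj₁ L'<L)
  lex-suc (inj₂ (L'≡L , p<1+a)) with m≤n⇒m<n∨m≡n (s≤s⁻¹ p<1+a)
  ... | inj₁ p<a = inj₁ (inj₂ (L'≡L , p<a))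
  ... | inj₂ p≡a = inj₂ (L'≡L , p≡a)

  sweep-push : ∀ {L a acc} → SweptUpTo L a acc → SweptUpTo L (suc a) (push L acc a)
  sweep-push {L} {a} {acc} (adm , visited , complete) with E a (a + L) in new∈E
  ... | true =
    (inR new∈E , All.map (λ {t} → visited⇒precedes t new∈E) visited , adm) ,
    (new∈E , L , refl , inj₂ (refl , ≤-refl)) ∷ All.map (λ {t} → visited-suc t) visited ,
    complete′
    where
    complete′ : Complete L (suc a) ((a , a + L) ∷ acc)
    complete′ p L' earlier p∈E with lex-suc earlier
    ... | inj₁ before        = member-there (a , a + L) acc p (p + L') (complete p L' before p∈E)
    ... | inj₂ (refl , refl) = member-here p (p + L) acc
  ... | false = adm , All.map (λ {t} → visited-suc t) visited , complete′
    where
    complete′ : Complete L (suc a) acc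
    complete′ p L' earlier p∈E with lex-suc earlier
    ... | inj₁ before        = complete p L' before p∈E
    ... | inj₂ (refl , refl) with trans (sym p∈E) new∈E
    ...   | ()

  sweep-pass : ∀ {L acc} k → SweptUpTo L 1 acc → SweptUpTo L (suc k) (foldl (push L) acc (range 1 (suc k)))
  sweep-pass zero swept = swept
  sweep-pass {L} {acc} (suc k) swept =
    subst (SweptUpTo L (suc (suc k))) (sym (foldl-range-snoc (push L) acc k)) (sweep-push (sweep-pass k swept))

  sweep-nextLength : ∀ {L acc} → SweptUpTo L (suc n) acc → SweptUpTo (suc L) 1 acc
  sweep-nextLength {L} {acc} (adm , visited , complete) = adm , All.map (λ {t} → visited-next t) visited , complete′
    where
    visited-next : ∀ t → Visited L (suc n) t → Visited (suc L) 1 t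
    visited-next _ (∈E , L' , q≡ , inj₁ L'<L)      = ∈E , L' , q≡ , inj₁ (m<n⇒m<1+n L'<L)
    visited-next _ (∈E , L' , q≡ , inj₂ (refl , _)) = ∈E , L' , q≡ , inj₁ ≤-refl
    complete′ : Complete (suc L) 1 acc
    complete′ p L' (inj₂ (_ , p<1)) p∈E = ⊥-elim (≤⇒≯ (proj₁ (inR p∈E)) p<1)
    complete′ p L' (inj₁ L'<1+L) p∈E with m≤n⇒m<n∨m≡n (s≤s⁻¹ L'<1+L)
    ... | inj₁ L'<L = complete p L' (inj₁ L'<L) p∈E
    ... | inj₂ refl = complete p L' (inj₂ (refl , s≤s p≤n)) p∈E
      where
      p≤n : p ≤ n
      p≤n = ≤-trans (m≤m+n p L') (proj₂ (proj₂ (inR p∈E)))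

  swept-segments : ∀ k → SweptUpTo (suc k) 1 (foldl pass [] (range 1 (suc k)))
  swept-segments zero = tt , [] , nothing-before
    where
    nothing-before : Complete 1 1 []
    nothing-before p .0 (inj₁ (s≤s z≤n)) p∈E = ⊥-elim (<-irrefl (sym (+-identityʳ p)) (proj₁ (proj₂ (inR p∈E))))
    nothing-before p L' (inj₂ (_ , p<1)) p∈E = ⊥-elim (≤⇒≯ (proj₁ (inR p∈E)) p<1)
  swept-segments (suc k) =
    subst (SweptUpTo (suc (suc k)) 1) (sym (foldl-range-snoc pass [] k)) (sweep-nextLength (sweep-pass n (swept-segments k)))

  member-swept : ∀ {L rs} → SweptUpTo L 1 rs → (∀ {p q} → E p q ≡ true → q ∸ p < L) → ∀ p q → member rs p q ≡ E p q
  member-swept {L} {rs} (_ , visited , complete) short p q with E p q in pq∈E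
  ... | true = subst (λ z → member rs p z ≡ true) p+[q∸p]≡q
                 (complete p (q ∸ p) (inj₁ (short pq∈E)) (trans (cong (E p) p+[q∸p]≡q) pq∈E))
    where
    p+[q∸p]≡q : p + (q ∸ p) ≡ q
    p+[q∸p]≡q = m+[n∸m]≡n (<⇒≤ (proj₁ (proj₂ (inR pq∈E))))
  ... | false = ¬-not λ ∈rs → case trans (sym (proj₁ (member-All rs p q visited ∈rs))) pq∈E of λ ()

proposition3p7 : (n : ℕ) → 2 ≤ n → (a : ℕ → ℕ) → (E : SegSet) → InRp n E →
    Σ Point (IsXE n a E) ×
    (∀ x → IsXE n a E x →
      ℤ.+ 2 ℤ.* bSum n x ≡ ℤ.+ (sum (map (λ i → ∣ lam a n i - lam a n (w n E i) ∣) (range 1 (suc n)))))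
proposition3p7 (suc zero)    (s≤s ())
proposition3p7 (suc (suc k)) _ a E E∈Rp =
  (proj₁ xE , IsXE-cong member≡E (proj₂ xE)) , twice-bSum
  where
  n : ℕ
  n = suc (suc k)
  open Sweep n E E∈Rp
  open ForSegments n a
  swept : SweptUpTo n 1 segments
  swept = swept-segments (suc k)
  member≡E : ∀ p q → member segments p q ≡ E p q
  member≡E = member-swept swept length<n
  xE : Σ Point (IsXE n a (member segments))
  xE = xE-exists segments (proj₁ swept)
  twice-bSum : ∀ x → IsXE n a E x →
    + 2 *ℤ bSum n x ≡ + sum (map (λ i → ∣ lam a n i - lam a n (w n E i) ∣) (range 1 (suc n)))
  twice-bSum x hx = begin
    + 2 *ℤ bSum n x
      ≡⟨ proj₂ (invariant segments (proj₁ swept) x (IsXE-cong (λ p q → sym (member≡E p q)) hx)) ⟩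
    displacement segments
      ≡⟨ ∑-cong _ _ 1 (suc n) (λ m _ _ → cong (λ z → + ∣ lam a n m - lam a n z ∣) (perm-segments≡w m)) ⟩
    sumℤ (map (λ i → + ∣ lam a n i - lam a n (w n E i) ∣) (range 1 (suc n)))
      ≡⟨ +-sum (λ i → ∣ lam a n i - lam a n (w n E i) ∣) (range 1 (suc n)) ⟨
    + sum (map (λ i → ∣ lam a n i - lam a n (w n E i) ∣) (range 1 (suc n))) ∎
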